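{- For each integer $k\geq 0$, let $N_k=3\cdot 4^k$. Then there exists a set $C_k\subseteq \mathbb{N}$ such that $R_2(C_k,n)=R_2(\mathbb{N}\setminus C_k,n)$ for all integers $n\geq 2N_k-1$, $|C_k\cap A_0|=+\infty$, $|C_k\cap B_0|=+\infty$, and $$R_2\left(C_k,\tfrac{14}{3}N_k-1\right)=0.$$
   Context: $\mathbb{N}$ denotes the set of nonnegative integers (including $0$). For $A\subseteq\mathbb{N}$ and an integer $n$, $R_2(A,n)$ denotes the number of solutions of $n=a+a'$ with $a,a'\in A$ and $a<a'$. For $a\in\mathbb{N}$, $D(a)$ is the number of ones in the binary representation of $a$ (with $D(0)=0$). $A_0$ is the set of all $a\in\mathbb{N}$ with $D(a)$ even (the Thue–Morse set), and $B_0=\mathbb{N}\setminus A_0$. -}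

module Defs where

open import Data.Nat using (ℕ; zero; suc; _+_; _*_; _∸_; _^_; _≤_; _<ᵇ_)
open import Data.Nat.DivMod using (_%_; _/_)
open import Data.Bool using (Bool; true; false; _∧_; not)
open import Data.List using (List; length; filterᵇ; upTo)
open import Data.Product using (∃; _×_)
open import Relation.Binary.PropositionalEquality using (_≡_)

Subset : Set
Subset = ℕ → Bool

∁ : Subset → Subset
∁ C a = not (C a)

-- R₂(C, n) = #{(a, a') : a, a' ∈ C, a < a', a + a' = n}
-- Every such pair is determined by a ∈ {0..n} with a < n ∸ a, a' = n ∸ a.
R₂ : Subset → ℕ → ℕ
R₂ C n = length (filterᵇ (λ a → (a <ᵇ (n ∸ a)) ∧ (C a ∧ C (n ∸ a))) (upTo (suc n)))

-- number of ones in the binary representation (fuel = n suffices, since n / 2 < n)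
private
  ones : ℕ → ℕ → ℕ
  ones zero    _ = 0
  ones (suc f) n = n % 2 + ones f (n / 2)

D : ℕ → ℕ
D n = ones n n

A₀ : Subset
A₀ a = (D a % 2) Data.Nat.≡ᵇ 0

B₀ : Subset
B₀ = ∁ A₀

InfiniteInter : Subset → Subset → Set
InfiniteInter C S = ∀ m → ∃ λ a → m ≤ a × C a ≡ true × S a ≡ true

N : ℕ → ℕ
N k = 3 * 4 ^ k

{-# OPTIONS --safe #-}
module Submission where

-- Let F_t be the set of a ≥ t whose binary expansion begins with 10, and C_t = A₀ Δ F_t;
-- we take C = C_t with t = 4^(k+1). For even t ≥ 2, C_t(2q+1) = ¬ C_t(2q) and C_t(2q) = C_(t/2)(q).
-- The first relation pairs 2q with 2q+1, so counting gives R₂(C, n) = R₂(ℕ∖C, n) for odd n, and for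
-- n = 2m as soon as C(2m) = C(m); the latter holds for m ≥ 3·4^k, because F_(t/2) and F_t differ
-- only on [t/2, t), and the numbers in [3t/4, t) begin with 11.
-- Halving along a + b + 1 = 7·2^i, both relations show that C_(2^(i+1))(a) xor C_(2^(i+1))(b) is the
-- parity of i (the case a + b = 6 is a computation). For i = 2k+1 it is true: no two elements of C
-- add up to 14·4^k − 1.

open import Defs
open import Data.Nat using (ℕ; zero; suc; _+_; _*_; _∸_; _^_; _≤_; _<_; z≤n; s≤s; _≤ᵇ_; _<ᵇ_; _≡ᵇ_)
open import Data.Nat.Properties
open import Data.Nat.DivMod using (_%_; _/_; m/n≡1+[m∸n]/n; m/n<m)
open import Data.Nat.Solver using (module +-*-Solver)
open import Data.Bool using (Bool; true; false; _∧_; not; _xor_; if_then_else_; T)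
open import Data.Bool.Properties using (∧-identityʳ; ∧-zeroʳ; xor-comm; not-distribˡ-xor; not-distribʳ-xor; T-≡)
open import Data.List using (length; filterᵇ; applyUpTo)
open import Data.Empty using (⊥-elim)
open import Data.Product using (∃; _×_; _,_)
open import Function using (_∘_; id)
open import Function.Bundles using (Equivalence)
open import Relation.Binary.PropositionalEquality
open import Relation.Nullary using (yes; no)

open +-*-Solver using (solve; _:+_; _:*_; _:=_; con)

T⇒≡true : ∀ {b} → T b → b ≡ true
T⇒≡true = Equivalence.to T-≡

double : ℕ → ℕ
double zero    = zero
double (suc n) = suc (suc (double n))

double≡+ : ∀ n → double n ≡ n + n
double≡+ zero    = refl
double≡+ (suc n) = cong suc (trans (cong suc (double≡+ n)) (sym (+-suc n n)))

double≡2* : ∀ n → double n ≡ 2 * n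
double≡2* n = trans (double≡+ n) (cong (n +_) (sym (+-identityʳ n)))

double-distrib-+ : ∀ a b → double (a + b) ≡ double a + double b
double-distrib-+ zero    b = refl
double-distrib-+ (suc a) b = cong (suc ∘ suc) (double-distrib-+ a b)

*-double : ∀ c p → c * double p ≡ double (c * p)
*-double c p rewrite double≡2* p | double≡2* (c * p) =
  solve 2 (λ c p → c :* (con 2 :* p) := con 2 :* (c :* p)) refl c p

double-injective : ∀ {x y} → double x ≡ double y → x ≡ y
double-injective {zero}  {zero}  _ = refl
double-injective {suc x} {suc y} e = cong suc (double-injective (suc-injective (suc-injective e)))

double≢suc-double : ∀ x y → double x ≢ suc (double y)
double≢suc-double (suc x)       (suc y) e = double≢suc-double x y (suc-injective (suc-injective e))
double≢suc-double (suc zero)    zero    ()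
double≢suc-double (suc (suc x)) zero    ()

double-≥ : ∀ q → q ≤ double q
double-≥ q = subst (q ≤_) (sym (double≡+ q)) (m≤m+n q q)

double-mono-≤ : ∀ {x y} → x ≤ y → double x ≤ double y
double-mono-≤ {x} {y} h = subst₂ _≤_ (sym (double≡+ x)) (sym (double≡+ y)) (+-mono-≤ h h)

double-cancel-≤ : ∀ {x y} → double x ≤ double y → x ≤ y
double-cancel-≤ {zero}          _             = z≤n
double-cancel-≤ {suc x} {suc y} (s≤s (s≤s h)) = s≤s (double-cancel-≤ h)

double-cancel-≤-suc : ∀ {x y} → double x ≤ suc (double y) → x ≤ y
double-cancel-≤-suc {zero}          _             = z≤n
double-cancel-≤-suc {suc x} {zero}  (s≤s ())
double-cancel-≤-suc {suc x} {suc y} (s≤s (s≤s h)) = s≤s (double-cancel-≤-suc h)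

double-cancel-< : ∀ {x y} → double x < double y → x < y
double-cancel-< {x} {suc y} (s≤s h) = s≤s (double-cancel-≤-suc h)

double-double : ∀ x → double (double x) ≡ 4 * x
double-double x rewrite double≡2* (double x) | double≡2* x =
  solve 1 (λ x → con 2 :* (con 2 :* x) := con 4 :* x) refl x

data EvenOdd : ℕ → Set where
  even : ∀ q → EvenOdd (double q)
  odd  : ∀ q → EvenOdd (suc (double q))

evenOdd : ∀ n → EvenOdd n
evenOdd zero = even 0
evenOdd (suc n) with evenOdd n
... | even q = odd q
... | odd q  = even (suc q)

half-suc-suc : ∀ x → suc (suc x) / 2 ≡ suc (x / 2)
half-suc-suc x = m/n≡1+[m∸n]/n {suc (suc x)} {2} (s≤s (s≤s z≤n))

double-/2 : ∀ q → double q / 2 ≡ q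
double-/2 zero    = refl
double-/2 (suc q) = trans (half-suc-suc (double q)) (cong suc (double-/2 q))

suc-double-/2 : ∀ q → suc (double q) / 2 ≡ q
suc-double-/2 zero    = refl
suc-double-/2 (suc q) = trans (half-suc-suc (suc (double q))) (cong suc (suc-double-/2 q))

double-%2 : ∀ q → double q % 2 ≡ 0
double-%2 zero    = refl
double-%2 (suc q) = double-%2 q

suc-double-%2 : ∀ q → suc (double q) % 2 ≡ 1
suc-double-%2 zero    = refl
suc-double-%2 (suc q) = suc-double-%2 q

doubleⁿ : ℕ → ℕ → ℕ
doubleⁿ zero    x = x
doubleⁿ (suc j) x = double (doubleⁿ j x)

doubleⁿ-≥ : ∀ j x → x ≤ doubleⁿ j x
doubleⁿ-≥ zero    x = ≤-refl
doubleⁿ-≥ (suc j) x = ≤-trans (doubleⁿ-≥ j x) (double-≥ _)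

doubleⁿ-mono-≤ : ∀ j {x y} → x ≤ y → doubleⁿ j x ≤ doubleⁿ j y
doubleⁿ-mono-≤ zero    h = h
doubleⁿ-mono-≤ (suc j) h = double-mono-≤ (doubleⁿ-mono-≤ j h)

doubleⁿ->-exponent : ∀ j x → 1 ≤ x → j < doubleⁿ j x
doubleⁿ->-exponent zero    x h = h
doubleⁿ->-exponent (suc j) x h = subst₂ _≤_ (+-comm (suc j) 1) (sym (double≡+ (doubleⁿ j x)))
  (+-mono-≤ (doubleⁿ->-exponent j x h) (≤-trans (s≤s z≤n) (doubleⁿ->-exponent j x h)))

pow2 : ℕ → ℕ
pow2 i = doubleⁿ i 1

pow2-positive : ∀ i → 1 ≤ pow2 i
pow2-positive i = doubleⁿ-≥ i 1

pow2-suc-≥2 : ∀ i → 2 ≤ pow2 (suc i)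
pow2-suc-≥2 i = double-mono-≤ (pow2-positive i)

pow2-+-self : ∀ k → pow2 (k + k) ≡ 4 ^ k
pow2-+-self zero    = refl
pow2-+-self (suc k) rewrite +-suc k k = trans (double-double (pow2 (k + k))) (cong (4 *_) (pow2-+-self k))

-- Digit sums and the Thue–Morse set

half-suc-≤ : ∀ n → suc n / 2 ≤ n
half-suc-≤ n = ≤-pred (m/n<m (suc n) 2 (s≤s (s≤s z≤n)))

halving-fuel-irrelevant : {A : Set} (F : ℕ → ℕ → A) (step : ℕ → A → A) →
  (∀ f n → F (suc f) n ≡ step n (F f (n / 2))) → (∀ f → F f 0 ≡ F 0 0) →
  ∀ f g n → n ≤ f → n ≤ g → F f n ≡ F g n
halving-fuel-irrelevant F step unfold F-zero = go
  where
  half≤ : ∀ n f → n ≤ suc f → n / 2 ≤ f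
  half≤ zero    f _ = z≤n
  half≤ (suc n) f p = ≤-trans (half-suc-≤ n) (≤-pred p)

  go : ∀ f g n → n ≤ f → n ≤ g → F f n ≡ F g n
  go zero    g       .0 z≤n _   = sym (F-zero g)
  go (suc f) zero    .0 _   z≤n = F-zero (suc f)
  go (suc f) (suc g) n  p   q   = begin
    F (suc f) n            ≡⟨ unfold f n ⟩
    step n (F f (n / 2))   ≡⟨ cong (step n) (go f g (n / 2) (half≤ n f p) (half≤ n g q)) ⟩
    step n (F g (n / 2))   ≡⟨ unfold g n ⟨
    F (suc g) n            ∎
    where open ≡-Reasoning

-- Defs counts binary digits with a private fuel-indexed function; unification against
-- the unfolding of D (made rigid by the with-abstraction) solves this meta to it.
mutual
  onesWithFuel : ℕ → ℕ → ℕ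
  onesWithFuel = _

  D-unfold : ∀ m → D (suc m) ≡ suc m % 2 + onesWithFuel m (suc m / 2)
  D-unfold m with suc m / 2
  ... | half = refl

onesWithFuel-zero : ∀ f → onesWithFuel f 0 ≡ 0
onesWithFuel-zero zero    = refl
onesWithFuel-zero (suc f) = onesWithFuel-zero f

D-halve : ∀ n → D n ≡ n % 2 + D (n / 2)
D-halve zero    = refl
D-halve (suc m) = trans (D-unfold m) (cong (suc m % 2 +_)
  (halving-fuel-irrelevant onesWithFuel (λ n r → n % 2 + r) (λ _ _ → refl) onesWithFuel-zero
    m (suc m / 2) (suc m / 2) (half-suc-≤ m) ≤-refl))

D-double : ∀ q → D (double q) ≡ D q
D-double q = trans (D-halve (double q)) (cong₂ _+_ (double-%2 q) (cong D (double-/2 q)))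

D-suc-double : ∀ q → D (suc (double q)) ≡ suc (D q)
D-suc-double q = trans (D-halve (suc (double q))) (cong₂ _+_ (suc-double-%2 q) (cong D (suc-double-/2 q)))

even?-suc : ∀ x → (suc x % 2 ≡ᵇ 0) ≡ not (x % 2 ≡ᵇ 0)
even?-suc zero          = refl
even?-suc (suc zero)    = refl
even?-suc (suc (suc x)) = even?-suc x

A₀-double : ∀ q → A₀ (double q) ≡ A₀ q
A₀-double q = cong (λ d → d % 2 ≡ᵇ 0) (D-double q)

A₀-suc-double : ∀ q → A₀ (suc (double q)) ≡ not (A₀ q)
A₀-suc-double q = trans (cong (λ d → d % 2 ≡ᵇ 0) (D-suc-double q)) (even?-suc (D q))

A₀-doubleⁿ : ∀ j x → A₀ (doubleⁿ j x) ≡ A₀ x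
A₀-doubleⁿ zero    x = refl
A₀-doubleⁿ (suc j) x = trans (A₀-double (doubleⁿ j x)) (A₀-doubleⁿ j x)

-- Numbers whose binary expansion begins with 10

startsWith10From : ℕ → ℕ → Bool
startsWith10From zero    n = false
startsWith10From (suc f) n = if n <ᵇ 4 then n ≡ᵇ 2 else startsWith10From f (n / 2)

startsWith10 : ℕ → Bool
startsWith10 n = startsWith10From n n

startsWith10From-zero : ∀ f → startsWith10From f 0 ≡ false
startsWith10From-zero zero    = refl
startsWith10From-zero (suc f) = refl

startsWith10-halve : ∀ n → 4 ≤ n → startsWith10 n ≡ startsWith10 (n / 2)
startsWith10-halve (suc f) (s≤s (s≤s (s≤s (s≤s _)))) =
  halving-fuel-irrelevant startsWith10From (λ n r → if n <ᵇ 4 then n ≡ᵇ 2 else r) (λ _ _ → refl)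
    startsWith10From-zero f (suc f / 2) (suc f / 2) (half-suc-≤ f) ≤-refl

startsWith10-double : ∀ q → 2 ≤ q → startsWith10 (double q) ≡ startsWith10 q
startsWith10-double q q≥2 =
  trans (startsWith10-halve (double q) (double-mono-≤ q≥2)) (cong startsWith10 (double-/2 q))

startsWith10-suc-double : ∀ q → 2 ≤ q → startsWith10 (suc (double q)) ≡ startsWith10 q
startsWith10-suc-double q q≥2 =
  trans (startsWith10-halve (suc (double q)) (m≤n⇒m≤1+n (double-mono-≤ q≥2))) (cong startsWith10 (suc-double-/2 q))

startsWith10-doubleⁿ : ∀ j x → 2 ≤ x → startsWith10 (doubleⁿ j x) ≡ startsWith10 x
startsWith10-doubleⁿ zero    x h = refl
startsWith10-doubleⁿ (suc j) x h =
  trans (startsWith10-double (doubleⁿ j x) (≤-trans h (doubleⁿ-≥ j x))) (startsWith10-doubleⁿ j x h)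

≥3·2ʲ⇒≥2 : ∀ j {x} → 3 * pow2 j ≤ x → 2 ≤ x
≥3·2ʲ⇒≥2 j h = ≤-trans (s≤s (s≤s z≤n)) (≤-trans (*-monoʳ-≤ 3 (pow2-positive j)) h)

startsWith10-from-3·2ʲ-to-4·2ʲ : ∀ j m → 3 * pow2 j ≤ m → m < 4 * pow2 j → startsWith10 m ≡ false
startsWith10-from-3·2ʲ-to-4·2ʲ zero m lo hi rewrite ≤-antisym (≤-pred hi) lo = refl
startsWith10-from-3·2ʲ-to-4·2ʲ (suc j) m lo hi with evenOdd m
... | even x = trans (startsWith10-double x (≥3·2ʲ⇒≥2 j x≥3p)) (startsWith10-from-3·2ʲ-to-4·2ʲ j x x≥3p x<4p)
  where
  x≥3p : 3 * pow2 j ≤ x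
  x≥3p = double-cancel-≤ (subst (_≤ double x) (*-double 3 (pow2 j)) lo)
  x<4p : x < 4 * pow2 j
  x<4p = double-cancel-< (subst (double x <_) (*-double 4 (pow2 j)) hi)
... | odd x = trans (startsWith10-suc-double x (≥3·2ʲ⇒≥2 j x≥3p)) (startsWith10-from-3·2ʲ-to-4·2ʲ j x x≥3p x<4p)
  where
  x≥3p : 3 * pow2 j ≤ x
  x≥3p = double-cancel-≤-suc (subst (_≤ suc (double x)) (*-double 3 (pow2 j)) lo)
  x<4p : x < 4 * pow2 j
  x<4p = double-cancel-≤ (subst (suc (double x) <_) (*-double 4 (pow2 j)) hi)

-- The twisted Thue–Morse sets

flipRegion : ℕ → ℕ → Bool
flipRegion t a = (t ≤ᵇ a) ∧ startsWith10 a

twisted : ℕ → Subset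
twisted t a = A₀ a xor flipRegion t a

≤ᵇ-suc : ∀ x y → (suc x ≤ᵇ suc y) ≡ (x ≤ᵇ y)
≤ᵇ-suc zero    y = refl
≤ᵇ-suc (suc x) y = refl

double-≤ᵇ-double : ∀ a b → (double a ≤ᵇ double b) ≡ (a ≤ᵇ b)
double-≤ᵇ-double zero    b       = refl
double-≤ᵇ-double (suc a) zero    = refl
double-≤ᵇ-double (suc a) (suc b) = trans (≤ᵇ-suc (suc (double a)) (suc (double b)))
  (trans (≤ᵇ-suc (double a) (double b)) (trans (double-≤ᵇ-double a b) (sym (≤ᵇ-suc a b))))

double-≤ᵇ-suc-double : ∀ a b → (double a ≤ᵇ suc (double b)) ≡ (a ≤ᵇ b)
double-≤ᵇ-suc-double zero    b       = refl
double-≤ᵇ-suc-double (suc a) zero    = refl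
double-≤ᵇ-suc-double (suc a) (suc b) = trans (≤ᵇ-suc (suc (double a)) (suc (suc (double b))))
  (trans (≤ᵇ-suc (double a) (suc (double b))) (trans (double-≤ᵇ-suc-double a b) (sym (≤ᵇ-suc a b))))

flipRegion-double : ∀ t q → 2 ≤ t → flipRegion (double t) (double q) ≡ flipRegion t q
flipRegion-double t q t≥2 rewrite double-≤ᵇ-double t q with t ≤ᵇ q in t≤q
... | true  = startsWith10-double q (≤-trans t≥2 (≤ᵇ⇒≤ t q (subst T (sym t≤q) _)))
... | false = refl

flipRegion-suc-double : ∀ t q → 2 ≤ t → flipRegion (double t) (suc (double q)) ≡ flipRegion t q
flipRegion-suc-double t q t≥2 rewrite double-≤ᵇ-suc-double t q with t ≤ᵇ q in t≤q
... | true  = startsWith10-suc-double q (≤-trans t≥2 (≤ᵇ⇒≤ t q (subst T (sym t≤q) _)))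
... | false = refl

twisted-double : ∀ t q → 2 ≤ t → twisted (double t) (double q) ≡ twisted t q
twisted-double t q t≥2 = cong₂ _xor_ (A₀-double q) (flipRegion-double t q t≥2)

twisted-suc-double : ∀ t q → 2 ≤ t → twisted (double t) (suc (double q)) ≡ not (twisted t q)
twisted-suc-double t q t≥2 =
  trans (cong₂ _xor_ (A₀-suc-double q) (flipRegion-suc-double t q t≥2)) (sym (not-distribˡ-xor (A₀ q) _))

twisted-pairing : ∀ t q → 2 ≤ t → twisted (double t) (suc (double q)) ≡ not (twisted (double t) (double q))
twisted-pairing t q t≥2 = trans (twisted-suc-double t q t≥2) (cong not (sym (twisted-double t q t≥2)))

flipRegion-halve-threshold : ∀ j m → 3 * pow2 j ≤ m →
  flipRegion (pow2 (suc j)) m ≡ flipRegion (pow2 (suc (suc j))) m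
flipRegion-halve-threshold j m m≥3p with m <? pow2 (suc (suc j))
... | yes m<4p rewrite startsWith10-from-3·2ʲ-to-4·2ʲ j m m≥3p (subst (m <_) (double-double (pow2 j)) m<4p) =
  trans (∧-zeroʳ _) (sym (∧-zeroʳ _))
... | no m≮4p rewrite T⇒≡true (≤⇒≤ᵇ (≤-trans (double-≥ (pow2 (suc j))) (≮⇒≥ m≮4p)))
                    | T⇒≡true (≤⇒≤ᵇ (≮⇒≥ m≮4p)) = refl

twisted-halve : ∀ j m → 3 * pow2 j ≤ m →
  twisted (pow2 (suc (suc j))) (double m) ≡ twisted (pow2 (suc (suc j))) m
twisted-halve j m m≥3p = trans (twisted-double (pow2 (suc j)) m (pow2-suc-≥2 j))
  (cong (A₀ m xor_) (flipRegion-halve-threshold j m m≥3p))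

isOdd : ℕ → Bool
isOdd zero    = false
isOdd (suc i) = not (isOdd i)

isOdd-+-self : ∀ k → isOdd (k + k) ≡ false
isOdd-+-self zero    = refl
isOdd-+-self (suc k) rewrite +-suc k k | isOdd-+-self k = refl

suc-double-+-suc-double : ∀ a b → suc (double a + suc (double b)) ≡ double (suc (a + b))
suc-double-+-suc-double a b = cong suc (trans (+-suc (double a) (double b)) (cong suc (sym (double-distrib-+ a b))))

twisted-xor-even-odd : ∀ i a b →
  twisted (pow2 (suc (suc i))) (double a) xor twisted (pow2 (suc (suc i))) (suc (double b))
    ≡ not (twisted (pow2 (suc i)) a xor twisted (pow2 (suc i)) b)
twisted-xor-even-odd i a b = trans
  (cong₂ _xor_ (twisted-double _ a (pow2-suc-≥2 i)) (twisted-suc-double _ b (pow2-suc-≥2 i)))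
  (sym (not-distribʳ-xor (twisted (pow2 (suc i)) a) _))

twisted-xor-on-7·2ⁱ : ∀ i a b → suc (a + b) ≡ 7 * pow2 i →
  twisted (pow2 (suc i)) a xor twisted (pow2 (suc i)) b ≡ isOdd i
twisted-xor-on-7·2ⁱ zero 0 .6 refl = refl
twisted-xor-on-7·2ⁱ zero 1 .5 refl = refl
twisted-xor-on-7·2ⁱ zero 2 .4 refl = refl
twisted-xor-on-7·2ⁱ zero 3 .3 refl = refl
twisted-xor-on-7·2ⁱ zero 4 .2 refl = refl
twisted-xor-on-7·2ⁱ zero 5 .1 refl = refl
twisted-xor-on-7·2ⁱ zero 6 .0 refl = refl
twisted-xor-on-7·2ⁱ zero (suc (suc (suc (suc (suc (suc (suc a))))))) b ()
twisted-xor-on-7·2ⁱ (suc i) a b a+b+1≡7p with evenOdd a | evenOdd b | trans a+b+1≡7p (*-double 7 (pow2 i))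
... | even a′ | even b′ | e = ⊥-elim (double≢suc-double _ _ (sym (trans (cong suc (double-distrib-+ a′ b′)) e)))
... | odd a′  | odd b′  | e = ⊥-elim (double≢suc-double _ _ (sym (trans (cong suc (sym (suc-double-+-suc-double a′ b′))) e)))
... | even a′ | odd b′  | e = trans (twisted-xor-even-odd i a′ b′)
  (cong not (twisted-xor-on-7·2ⁱ i a′ b′ (double-injective (trans (sym (suc-double-+-suc-double a′ b′)) e))))
... | odd a′  | even b′ | e = trans (xor-comm (twisted (pow2 (suc (suc i))) (suc (double a′))) _) (trans (twisted-xor-even-odd i b′ a′)
  (cong not (twisted-xor-on-7·2ⁱ i b′ a′ (double-injective (trans (sym (suc-double-+-suc-double b′ a′))
    (trans (cong suc (+-comm (double b′) (suc (double a′)))) e))))))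

twisted-infinite-A₀ : ∀ t → InfiniteInter (twisted t) A₀
twisted-infinite-A₀ t m = a , <⇒≤ (doubleⁿ->-exponent m 3 (s≤s z≤n)) , a∈C , A₀-doubleⁿ m 3
  where
  a : ℕ
  a = doubleⁿ m 3
  a∈C : twisted t a ≡ true
  a∈C rewrite A₀-doubleⁿ m 3 | startsWith10-doubleⁿ m 3 (s≤s (s≤s z≤n)) | ∧-zeroʳ (t ≤ᵇ a) = refl

twisted-infinite-B₀ : ∀ i → InfiniteInter (twisted (pow2 i)) B₀
twisted-infinite-B₀ i m = a , <⇒≤ (doubleⁿ->-exponent m b b≥1) , a∈C , cong not a∉A₀
  where
  b a : ℕ
  b = doubleⁿ i 4
  a = doubleⁿ m b
  b≥1 : 1 ≤ b
  b≥1 = ≤-trans (s≤s z≤n) (doubleⁿ-≥ i 4)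
  a∉A₀ : A₀ a ≡ false
  a∉A₀ = trans (A₀-doubleⁿ m b) (A₀-doubleⁿ i 4)
  a-startsWith10 : startsWith10 a ≡ true
  a-startsWith10 = trans (startsWith10-doubleⁿ m b (≤-trans (s≤s (s≤s z≤n)) (doubleⁿ-≥ i 4)))
                         (startsWith10-doubleⁿ i 4 (s≤s (s≤s z≤n)))
  a≥t : pow2 i ≤ a
  a≥t = ≤-trans (doubleⁿ-mono-≤ i (s≤s z≤n)) (doubleⁿ-≥ m b)
  a∈C : twisted (pow2 i) a ≡ true
  a∈C rewrite a∉A₀ | a-startsWith10 | T⇒≡true (≤⇒≤ᵇ a≥t) = refl

-- Counting representations

sumBelow : ℕ → (ℕ → ℕ) → ℕ
sumBelow zero    g = 0
sumBelow (suc m) g = g 0 + sumBelow m (g ∘ suc)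

sumBelow-cong : ∀ m {g h} → (∀ a → a < m → g a ≡ h a) → sumBelow m g ≡ sumBelow m h
sumBelow-cong zero    e = refl
sumBelow-cong (suc m) e = cong₂ _+_ (e 0 (s≤s z≤n)) (sumBelow-cong m (λ a a<m → e (suc a) (s≤s a<m)))

sumBelow-distrib-+ : ∀ m g h → sumBelow m (λ a → g a + h a) ≡ sumBelow m g + sumBelow m h
sumBelow-distrib-+ zero    g h = refl
sumBelow-distrib-+ (suc m) g h rewrite sumBelow-distrib-+ m (g ∘ suc) (h ∘ suc) =
  solve 4 (λ x y z w → (x :+ y) :+ (z :+ w) := (x :+ z) :+ (y :+ w)) refl
    (g 0) (h 0) (sumBelow m (g ∘ suc)) (sumBelow m (h ∘ suc))

sumBelow-suc : ∀ m g → sumBelow (suc m) g ≡ sumBelow m g + g m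
sumBelow-suc zero    g = +-comm (g 0) 0
sumBelow-suc (suc m) g = trans (cong (g 0 +_) (sumBelow-suc m (g ∘ suc))) (sym (+-assoc (g 0) _ _))

sumBelow-reverse : ∀ m g → sumBelow (suc m) (λ a → g (m ∸ a)) ≡ sumBelow (suc m) g
sumBelow-reverse zero    g = refl
sumBelow-reverse (suc m) g =
  trans (cong (g (suc m) +_) (sumBelow-reverse m g)) (trans (+-comm (g (suc m)) _) (sym (sumBelow-suc (suc m) g)))

sumBelow-zeros : ∀ m g → (∀ a → a < m → g a ≡ 0) → sumBelow m g ≡ 0
sumBelow-zeros zero    g e = refl
sumBelow-zeros (suc m) g e = cong₂ _+_ (e 0 (s≤s z≤n)) (sumBelow-zeros m (g ∘ suc) (λ a a<m → e (suc a) (s≤s a<m)))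

sumBelow-single : ∀ m g c → c < m → (∀ a → a < m → a ≢ c → g a ≡ 0) → sumBelow m g ≡ g c
sumBelow-single (suc m) g c c<1+m e with m ≟ c
... | yes refl = trans (sumBelow-suc m g)
  (cong (_+ g m) (sumBelow-zeros m g (λ a a<m → e a (m<n⇒m<1+n a<m) (λ a≡m → <-irrefl a≡m a<m))))
... | no m≢c = trans (sumBelow-suc m g) (trans
  (cong₂ _+_ (sumBelow-single m g c (≤∧≢⇒< (≤-pred c<1+m) (m≢c ∘ sym)) (λ a a<m → e a (m<n⇒m<1+n a<m)))
             (e m ≤-refl m≢c))
  (+-identityʳ (g c)))

sumBelow-ones : ∀ m → sumBelow m (λ _ → 1) ≡ m
sumBelow-ones zero    = refl
sumBelow-ones (suc m) = cong suc (sumBelow-ones m)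

indicator : Bool → ℕ
indicator true  = 1
indicator false = 0

countBelow : ℕ → (ℕ → Bool) → ℕ
countBelow m c = sumBelow m (indicator ∘ c)

length-filterᵇ-applyUpTo : ∀ (p : ℕ → Bool) (f : ℕ → ℕ) m →
  length (filterᵇ p (applyUpTo f m)) ≡ countBelow m (p ∘ f)
length-filterᵇ-applyUpTo p f zero    = refl
length-filterᵇ-applyUpTo p f (suc m) with p (f 0)
... | true  = cong suc (length-filterᵇ-applyUpTo p (f ∘ suc) m)
... | false = length-filterᵇ-applyUpTo p (f ∘ suc) m

indicator-not : ∀ x → indicator x + indicator (not x) ≡ 1
indicator-not true  = refl
indicator-not false = refl

indicator-inclusion-exclusion : ∀ p x y →
  indicator (p ∧ (x ∧ y)) + indicator p ≡ indicator (p ∧ (not x ∧ not y)) + (indicator (p ∧ x) + indicator (p ∧ y))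
indicator-inclusion-exclusion false x     y     = refl
indicator-inclusion-exclusion true  true  true  = refl
indicator-inclusion-exclusion true  true  false = refl
indicator-inclusion-exclusion true  false true  = refl
indicator-inclusion-exclusion true  false false = refl

indicator-trichotomy : ∀ x y c →
  indicator ((x <ᵇ y) ∧ c) + indicator ((y <ᵇ x) ∧ c) + indicator ((x ≡ᵇ y) ∧ c) ≡ indicator c
indicator-trichotomy zero    zero    c = refl
indicator-trichotomy zero    (suc y) c = trans (+-identityʳ _) (+-identityʳ _)
indicator-trichotomy (suc x) zero    c = +-identityʳ _
indicator-trichotomy (suc x) (suc y) c = indicator-trichotomy x y c

module PairCounts (n : ℕ) where
  smaller : ℕ → Bool
  smaller a = a <ᵇ n ∸ a

  centre : ℕ → Bool
  centre a = a ≡ᵇ n ∸ a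

  pairs : ℕ
  pairs = countBelow (suc n) smaller

  smallerIn largerIn centreIn : (ℕ → Bool) → ℕ
  smallerIn c = countBelow (suc n) (λ a → smaller a ∧ c a)
  largerIn  c = countBelow (suc n) (λ a → smaller a ∧ c (n ∸ a))
  centreIn  c = countBelow (suc n) (λ a → centre a ∧ c a)

  R₂≡count : ∀ C → R₂ C n ≡ countBelow (suc n) (λ a → smaller a ∧ (C a ∧ C (n ∸ a)))
  R₂≡count C = length-filterᵇ-applyUpTo (λ a → smaller a ∧ (C a ∧ C (n ∸ a))) id (suc n)

  R₂+pairs : ∀ C → R₂ C n + pairs ≡ R₂ (∁ C) n + (smallerIn C + largerIn C)
  R₂+pairs C = begin
    R₂ C n + pairs
      ≡⟨ cong (_+ pairs) (R₂≡count C) ⟩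
    sumBelow (suc n) (indicator ∘ both C) + sumBelow (suc n) (indicator ∘ smaller)
      ≡⟨ sumBelow-distrib-+ (suc n) (indicator ∘ both C) (indicator ∘ smaller) ⟨
    sumBelow (suc n) (λ a → indicator (both C a) + indicator (smaller a))
      ≡⟨ sumBelow-cong (suc n) (λ a _ → indicator-inclusion-exclusion (smaller a) (C a) (C (n ∸ a))) ⟩
    sumBelow (suc n) (λ a → indicator (both (∁ C) a) + (low a + high a))
      ≡⟨ sumBelow-distrib-+ (suc n) (indicator ∘ both (∁ C)) (λ a → low a + high a) ⟩
    sumBelow (suc n) (indicator ∘ both (∁ C)) + sumBelow (suc n) (λ a → low a + high a)
      ≡⟨ cong₂ _+_ (sym (R₂≡count (∁ C))) (sumBelow-distrib-+ (suc n) low high) ⟩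
    R₂ (∁ C) n + (smallerIn C + largerIn C) ∎
    where
    open ≡-Reasoning
    both : Subset → ℕ → Bool
    both C a = smaller a ∧ (C a ∧ C (n ∸ a))
    low high : ℕ → ℕ
    low  a = indicator (smaller a ∧ C a)
    high a = indicator (smaller a ∧ C (n ∸ a))

  largerIn-reverse : ∀ c → largerIn c ≡ countBelow (suc n) (λ b → (n ∸ b <ᵇ b) ∧ c b)
  largerIn-reverse c = trans
    (sumBelow-cong (suc n) (λ a a≤n → cong (λ x → indicator ((x <ᵇ n ∸ a) ∧ c (n ∸ a))) (sym (m∸[m∸n]≡n (≤-pred a≤n)))))
    (sumBelow-reverse n (λ b → indicator ((n ∸ b <ᵇ b) ∧ c b)))

  smallerIn+largerIn+centreIn : ∀ c → smallerIn c + largerIn c + centreIn c ≡ countBelow (suc n) c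
  smallerIn+largerIn+centreIn c = begin
    smallerIn c + largerIn c + centreIn c
      ≡⟨ cong (λ x → smallerIn c + x + centreIn c) (largerIn-reverse c) ⟩
    sumBelow (suc n) below + sumBelow (suc n) above + sumBelow (suc n) mid
      ≡⟨ cong (_+ sumBelow (suc n) mid) (sumBelow-distrib-+ (suc n) below above) ⟨
    sumBelow (suc n) (λ a → below a + above a) + sumBelow (suc n) mid
      ≡⟨ sumBelow-distrib-+ (suc n) (λ a → below a + above a) mid ⟨
    sumBelow (suc n) (λ a → below a + above a + mid a)
      ≡⟨ sumBelow-cong (suc n) (λ a _ → indicator-trichotomy a (n ∸ a) (c a)) ⟩
    countBelow (suc n) c ∎
    where
    open ≡-Reasoning
    below above mid : ℕ → ℕ
    below a = indicator (smaller a ∧ c a)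
    above a = indicator ((n ∸ a <ᵇ a) ∧ c a)
    mid   a = indicator (centre a ∧ c a)

  pairs+pairs+centre : pairs + pairs + centreIn (λ _ → true) ≡ suc n
  pairs+pairs+centre = begin
    pairs + pairs + centreIn (λ _ → true)
      ≡⟨ cong (λ x → x + x + centreIn (λ _ → true)) smallerIn-all ⟨
    smallerIn (λ _ → true) + largerIn (λ _ → true) + centreIn (λ _ → true)
      ≡⟨ smallerIn+largerIn+centreIn (λ _ → true) ⟩
    countBelow (suc n) (λ _ → true)
      ≡⟨ sumBelow-ones (suc n) ⟩
    suc n ∎
    where
    open ≡-Reasoning
    smallerIn-all : smallerIn (λ _ → true) ≡ pairs
    smallerIn-all = sumBelow-cong (suc n) (λ a _ → cong indicator (∧-identityʳ (smaller a)))

open PairCounts using (pairs; smallerIn; largerIn; centreIn; R₂+pairs; smallerIn+largerIn+centreIn; pairs+pairs+centre)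

double-self∸ : ∀ m → double m ∸ m ≡ m
double-self∸ m = trans (cong (_∸ m) (double≡+ m)) (m+n∸n≡m m m)

centre⇒double : ∀ a n → a ≤ n → a ≡ n ∸ a → double a ≡ n
centre⇒double a n a≤n a≡n∸a = trans (double≡+ a) (trans (cong (a +_) a≡n∸a) (m+[n∸m]≡n a≤n))

centreIn-double : ∀ m c → centreIn (double m) c ≡ indicator (c m)
centreIn-double m c = trans (sumBelow-single (suc (double m)) _ m (s≤s (double-≥ m)) off-centre)
  (cong (λ b → indicator (b ∧ c m)) (trans (cong (m ≡ᵇ_) (double-self∸ m)) (T⇒≡true (≡⇒≡ᵇ m m refl))))
  where
  off-centre : ∀ a → a < suc (double m) → a ≢ m → indicator ((a ≡ᵇ double m ∸ a) ∧ c a) ≡ 0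
  off-centre a a≤2m a≢m with a ≡ᵇ double m ∸ a in eq
  ... | true  = ⊥-elim (a≢m (double-injective (centre⇒double a (double m) (≤-pred a≤2m) (≡ᵇ⇒≡ a _ (subst T (sym eq) _)))))
  ... | false = refl

centreIn-suc-double : ∀ m c → centreIn (suc (double m)) c ≡ 0
centreIn-suc-double m c = sumBelow-zeros (suc (suc (double m))) _ no-centre
  where
  no-centre : ∀ a → a < suc (suc (double m)) → indicator ((a ≡ᵇ suc (double m) ∸ a) ∧ c a) ≡ 0
  no-centre a a≤n with a ≡ᵇ suc (double m) ∸ a in eq
  ... | true  = ⊥-elim (double≢suc-double a m (centre⇒double a (suc (double m)) (≤-pred a≤n) (≡ᵇ⇒≡ a _ (subst T (sym eq) _))))
  ... | false = refl

pairs-double : ∀ m → pairs (double m) ≡ m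
pairs-double m = double-injective (trans (double≡+ _) (+-cancelʳ-≡ 1 _ _
  (trans (cong (pairs (double m) + pairs (double m) +_) (sym (centreIn-double m (λ _ → true))))
         (trans (pairs+pairs+centre (double m)) (+-comm 1 (double m))))))

pairs-suc-double : ∀ m → pairs (suc (double m)) ≡ suc m
pairs-suc-double m = double-injective (trans (double≡+ _) (trans (sym (+-identityʳ _))
  (trans (cong (pairs (suc (double m)) + pairs (suc (double m)) +_) (sym (centreIn-suc-double m (λ _ → true))))
         (pairs+pairs+centre (suc (double m))))))

module _ (C : Subset) (pairing : ∀ q → C (suc (double q)) ≡ not (C (double q))) where

  countBelow-double : ∀ m → countBelow (double m) C ≡ m
  countBelow-double zero    = refl
  countBelow-double (suc m) = begin
    countBelow (suc (suc (double m))) C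
      ≡⟨ sumBelow-suc (suc (double m)) (indicator ∘ C) ⟩
    countBelow (suc (double m)) C + indicator (C (suc (double m)))
      ≡⟨ cong (_+ indicator (C (suc (double m)))) (sumBelow-suc (double m) (indicator ∘ C)) ⟩
    countBelow (double m) C + indicator (C (double m)) + indicator (C (suc (double m)))
      ≡⟨ +-assoc (countBelow (double m) C) _ _ ⟩
    countBelow (double m) C + (indicator (C (double m)) + indicator (C (suc (double m))))
      ≡⟨ cong₂ _+_ (countBelow-double m) (trans (cong (λ b → indicator (C (double m)) + indicator b) (pairing m))
                                                (indicator-not (C (double m)))) ⟩
    m + 1
      ≡⟨ +-comm m 1 ⟩
    suc m ∎
    where open ≡-Reasoning

  smallerIn+largerIn≡pairs : ∀ n → (∀ m → n ≡ double m → C (double m) ≡ C m) → smallerIn n C + largerIn n C ≡ pairs n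
  smallerIn+largerIn≡pairs n C-halves with evenOdd n
  ... | even m = trans (+-cancelʳ-≡ (indicator (C m)) _ _ (begin
    smallerIn (double m) C + largerIn (double m) C + indicator (C m)
      ≡⟨ cong (smallerIn (double m) C + largerIn (double m) C +_) (centreIn-double m C) ⟨
    smallerIn (double m) C + largerIn (double m) C + centreIn (double m) C
      ≡⟨ smallerIn+largerIn+centreIn (double m) C ⟩
    countBelow (suc (double m)) C
      ≡⟨ sumBelow-suc (double m) (indicator ∘ C) ⟩
    countBelow (double m) C + indicator (C (double m))
      ≡⟨ cong₂ _+_ (countBelow-double m) (cong indicator (C-halves m refl)) ⟩
    m + indicator (C m) ∎)) (sym (pairs-double m))
    where open ≡-Reasoning
  ... | odd m = trans (begin
    smallerIn (suc (double m)) C + largerIn (suc (double m)) C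
      ≡⟨ +-identityʳ _ ⟨
    smallerIn (suc (double m)) C + largerIn (suc (double m)) C + 0
      ≡⟨ cong (smallerIn (suc (double m)) C + largerIn (suc (double m)) C +_) (centreIn-suc-double m C) ⟨
    smallerIn (suc (double m)) C + largerIn (suc (double m)) C + centreIn (suc (double m)) C
      ≡⟨ smallerIn+largerIn+centreIn (suc (double m)) C ⟩
    countBelow (double (suc m)) C
      ≡⟨ countBelow-double (suc m) ⟩
    suc m ∎) (sym (pairs-suc-double m))
    where open ≡-Reasoning

  R₂-complement : ∀ n → (∀ m → n ≡ double m → C (double m) ≡ C m) → R₂ C n ≡ R₂ (∁ C) n
  R₂-complement n C-halves = +-cancelʳ-≡ (pairs n) _ _
    (trans (R₂+pairs n C) (cong (R₂ (∁ C) n +_) (smallerIn+largerIn≡pairs n C-halves)))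

xor-true⇒∧-false : ∀ x y → x xor y ≡ true → x ∧ y ≡ false
xor-true⇒∧-false true  false _ = refl
xor-true⇒∧-false false y     _ = refl

R₂-zero : ∀ C n → (∀ a → a ≤ n → C a xor C (n ∸ a) ≡ true) → R₂ C n ≡ 0
R₂-zero C n complementary = trans (PairCounts.R₂≡count n C) (sumBelow-zeros (suc n) _ not-both)
  where
  not-both : ∀ a → a < suc n → indicator ((a <ᵇ n ∸ a) ∧ (C a ∧ C (n ∸ a))) ≡ 0
  not-both a a≤n rewrite xor-true⇒∧-false (C a) (C (n ∸ a)) (complementary a (≤-pred a≤n)) = cong indicator (∧-zeroʳ _)

2*-∸1≤double⇒≤ : ∀ x m → 2 * x ∸ 1 ≤ double m → x ≤ m
2*-∸1≤double⇒≤ x m h = double-cancel-≤-suc (subst (_≤ suc (double m)) (sym (double≡2* x)) (≤-trans (m≤n+m∸n (2 * x) 1) (s≤s h)))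

N≡3·2ᵏ⁺ᵏ : ∀ k → N k ≡ 3 * pow2 (k + k)
N≡3·2ᵏ⁺ᵏ k = cong (3 *_) (sym (pow2-+-self k))

14·4ᵏ≡7·2ᵏ⁺ᵏ⁺¹ : ∀ k → 14 * 4 ^ k ≡ 7 * pow2 (suc (k + k))
14·4ᵏ≡7·2ᵏ⁺ᵏ⁺¹ k rewrite double≡2* (pow2 (k + k)) | pow2-+-self k =
  solve 1 (λ x → con 14 :* x := con 7 :* (con 2 :* x)) refl (4 ^ k)

suc[14·4ᵏ∸1]≡7·2ᵏ⁺ᵏ⁺¹ : ∀ k → suc (14 * 4 ^ k ∸ 1) ≡ 7 * pow2 (suc (k + k))
suc[14·4ᵏ∸1]≡7·2ᵏ⁺ᵏ⁺¹ k rewrite 14·4ᵏ≡7·2ᵏ⁺ᵏ⁺¹ k =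
  trans (+-comm 1 _) (m∸n+n≡m (≤-trans (s≤s z≤n) (*-monoʳ-≤ 7 (pow2-positive (suc (k + k))))))

theorem2 : ∀ (k : ℕ) → ∃ λ (C : Subset) →
             (∀ (n : ℕ) → 2 * N k ∸ 1 ≤ n → R₂ C n ≡ R₂ (∁ C) n)
             × InfiniteInter C A₀
             × InfiniteInter C B₀
             × R₂ C (14 * 4 ^ k ∸ 1) ≡ 0
theorem2 k = C , balanced , twisted-infinite-A₀ t , twisted-infinite-B₀ i , sum-free
  where
  i t : ℕ
  i = suc (suc (k + k))
  t = pow2 i
  C : Subset
  C = twisted t
  balanced : ∀ n → 2 * N k ∸ 1 ≤ n → R₂ C n ≡ R₂ (∁ C) n
  balanced n n≥2N∸1 = R₂-complement C (λ q → twisted-pairing (pow2 (suc (k + k))) q (pow2-suc-≥2 (k + k))) n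
    (λ m n≡2m → twisted-halve (k + k) m
      (subst (_≤ m) (N≡3·2ᵏ⁺ᵏ k) (2*-∸1≤double⇒≤ (N k) m (subst (2 * N k ∸ 1 ≤_) n≡2m n≥2N∸1))))
  sum-free : R₂ C (14 * 4 ^ k ∸ 1) ≡ 0
  sum-free = R₂-zero C (14 * 4 ^ k ∸ 1) (λ a a≤n → trans
    (twisted-xor-on-7·2ⁱ (suc (k + k)) a _ (trans (cong suc (m+[n∸m]≡n a≤n)) (suc[14·4ᵏ∸1]≡7·2ᵏ⁺ᵏ⁺¹ k)))
    (cong not (isOdd-+-self k)))
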